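{- (1) For every $k\in\mathcal{K}$, $\frac{2k_\bullet}{p+1}-2\leq d_k^{\mathrm{ur}}\leq\frac{2k_\bullet}{p+1}+2$. (2) For any $k,k'\in\mathcal{K}$ with $k<k'$, we have $d_k^{\mathrm{ur}}\leq d_{k'}^{\mathrm{ur}}$ and $d_k^{\mathrm{Iw}}-d_k^{\mathrm{ur}}\leq d_{k'}^{\mathrm{Iw}}-d_{k'}^{\mathrm{ur}}$, and the second inequality is strict if $k'_\bullet\geq k_\bullet+2$. (3) For any distinct $k,k'\in\mathcal{K}$, if $d_k^{\mathrm{ur}}=d_{k'}^{\mathrm{ur}}$ or $d_k^{\mathrm{Iw}}-d_k^{\mathrm{ur}}=d_{k'}^{\mathrm{Iw}}-d_{k'}^{\mathrm{ur}}$, then $v_p(k-k')=0$.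
   Context: $p\geq 11$ is a prime, $a$ is an integer with $2\leq a\leq p-5$, and $s\in\{0,\dots,p-2\}$. For an integer $n$, $\{n\}\in\{0,\dots,p-2\}$ is its residue modulo $p-1$. Put $\delta=\frac{1}{p-1}(\{a+s\}+s-\{a+2s\})\in\{0,1\}$; if $a+s<p-1$ put $t_1=s+\delta$, $t_2=a+s+\delta+2$; if $a+s\geq p-1$ put $t_1=\{a+s\}+\delta+1$, $t_2=s+\delta+1$. Let $k_\varepsilon=2+\{a+2s\}$ and $\mathcal{K}=\{k\geq 2: k\equiv k_\varepsilon\pmod{p-1}\}$; for $k\in\mathcal{K}$ write $k=k_\varepsilon+k_\bullet(p-1)$ and put $d_k^{\mathrm{Iw}}=2k_\bullet+2-2\delta$ and $d_k^{\mathrm{ur}}=\lfloor\frac{k_\bullet-t_1}{p+1}\rfloor+\lfloor\frac{k_\bullet-t_2}{p+1}\rfloor+2$ (these are the dimensions $d_k^{\mathrm{Iw}}(\tilde\varepsilon_1)$, $d_k^{\mathrm{ur}}(\varepsilon_1)$ attached to a $\bar\rho$-relevant character $\varepsilon$ with parameter $s_\varepsilon=s$ in the work of Liu–Truong–Xiao–Zhao). $v_p$ is the $p$-adic valuation with $v_p(p)=1$. -}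

module Defs where

open import Data.Nat using (ℕ; zero; suc; _+_; _*_; _∸_; _<_; _≤_)
open import Data.Nat.DivMod using (_%_; _/_)
open import Data.Integer as ℤ using (ℤ; +_)
open import Data.Rational as ℚ using (ℚ; floor)
open import Relation.Nullary using (Dec; yes; no)
open import Data.Nat.Properties using (_<?_)
open import Relation.Binary.PropositionalEquality using (_≡_)
open import Data.Product using (_×_)

-- total versions of ℕ-mod and ℕ-div (the divisor p ∸ 1 is ≥ 10 in all uses)
modN : ℕ → ℕ → ℕ
modN n zero    = n
modN n (suc m) = n % suc m

divN : ℕ → ℕ → ℕ
divN n zero    = 0
divN n (suc m) = n / suc m

res : (p n : ℕ) → ℕ
res p n = modN n (p ∸ 1)

δ : (p a s : ℕ) → ℕ
δ p a s = divN ((res p (a + s) + s) ∸ res p (a + 2 * s)) (p ∸ 1)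

t₁ : (p a s : ℕ) → ℕ
t₁ p a s with a + s <? p ∸ 1
... | yes _ = s + δ p a s
... | no  _ = res p (a + s) + δ p a s + 1

t₂ : (p a s : ℕ) → ℕ
t₂ p a s with a + s <? p ∸ 1
... | yes _ = a + s + δ p a s + 2
... | no  _ = s + δ p a s + 1

kε : (p a s : ℕ) → ℕ
kε p a s = 2 + res p (a + 2 * s)

inK : (p a s k : ℕ) → Set
inK p a s k = (2 ≤ k) × (modN k (p ∸ 1) ≡ modN (kε p a s) (p ∸ 1))

kbul : (p a s k : ℕ) → ℕ
kbul p a s k = divN (k ∸ kε p a s) (p ∸ 1)

dIw : (p a s k : ℕ) → ℤ
dIw p a s k = + (2 * kbul p a s k + 2) ℤ.- + (2 * δ p a s)

dUr : (p a s k : ℕ) → ℤ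
dUr p a s k =
  floor ((+ kbul p a s k ℤ.- + t₁ p a s) ℚ./ suc p)
  ℤ.+ floor ((+ kbul p a s k ℤ.- + t₂ p a s) ℚ./ suc p)
  ℤ.+ + 2

toℚ : ℤ → ℚ
toℚ z = z ℚ./ 1

-- Write k = k_ε + k_•(p − 1) and zᵢ = k_• − tᵢ, so that d^ur = ⌊z₁/(p+1)⌋ + ⌊z₂/(p+1)⌋ + 2, while d^Iw grows by
-- exactly 2 per unit of k_•. Part (1) is the defining inequality of the floor together with t₁ + t₂ ≤ 2(p + 1).
-- Each floor is monotone in k_• and grows by at most Δ when k_• grows by Δ, and by at most Δ − 1 when Δ ≥ 2
-- (the divisor p + 1 is at least 2): this is part (2). For part (3), 1 ≤ t₂ − t₁ ≤ p, so shifting k_• by p makes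
-- one of the two floors jump; hence equal d^ur forces k′_• − k_• < p, and equal d^Iw − d^ur forces
-- k′_• − k_• ≤ 1. Then k′ − k = Δ(p − 1) with 0 < Δ < p, and Δ(p − 1) ≡ −Δ ≢ 0 (mod p).
module Submission where

open import Defs
open import Data.Nat as ℕ using (ℕ; zero; suc; z≤n; s≤s; s≤s⁻¹; NonZero)
import Data.Nat.Properties as ℕP
import Data.Nat.Tactic.RingSolver as ℕ-Solver
open import Data.Integer as ℤ using (ℤ; +_)
import Data.Integer.Properties as ℤP
open import Data.Integer.Tactic.RingSolver using (solve-∀)
open import Data.Rational as ℚ using (floor; ↥_; ↧_; ↧ₙ_)
open import Data.Product using (_×_; _,_; proj₁; proj₂; Σ-syntax)
open import Data.Sum using (_⊎_; inj₁; inj₂)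
import Data.Sum as Sum
open import Relation.Nullary using (¬_; yes; no; contradiction)
open import Relation.Binary.Definitions using (tri<; tri≈; tri>)
open import Relation.Binary.PropositionalEquality
  using (_≡_; _≢_; refl; sym; trans; cong; cong₂; subst; subst₂; module ≡-Reasoning)

⌊_/suc_⌋ : ℤ → ℕ → ℤ
⌊ z /suc n ⌋ = floor (z ℚ./ suc n)

module FloorDivision where
  open import Data.Integer using (_+_; _*_; _≤_; _<_)
  open import Data.Integer.DivMod using ([n/d]*d≤n; n<s[n/ℕd]*d; div-pos-is-/ℕ)
  open import Data.Nat.GCD using (gcd)
  open import Data.Rational.Properties using (↥-/; ↧-/)

  floor*↧≤↥ : ∀ q → floor q * ↧ q ≤ ↥ q
  floor*↧≤↥ q@record{} = [n/d]*d≤n (↥ q) (↧ q)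

  ↥<suc[floor]*↧ : ∀ q → ↥ q < ℤ.suc (floor q) * ↧ q
  ↥<suc[floor]*↧ q@record{} =
    subst (λ x → ↥ q < ℤ.suc x * ↧ q) (sym (div-pos-is-/ℕ (↥ q) (↧ₙ q))) (n<s[n/ℕd]*d (↥ q) (↧ₙ q))

  -- z / (1 + n) is normalised by g = gcd z (1 + n); scaling the bounds for its floor by g recovers z and 1 + n.
  ⌊/suc⌋-bounds : ∀ z n → ⌊ z /suc n ⌋ * + suc n ≤ z × z < ℤ.suc ⌊ z /suc n ⌋ * + suc n
  ⌊/suc⌋-bounds z n = unscale (gcd ℤ.∣ z ∣ (suc n)) (↥-/ z (suc n)) (↧-/ z (suc n))
    where
    q : ℚ.ℚ
    q = z ℚ./ suc n
    unscale : ∀ g → ↥ q * + g ≡ z → ↧ q * + g ≡ + suc n →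
              floor q * + suc n ≤ z × z < ℤ.suc (floor q) * + suc n
    unscale zero _ ↧q*0≡1+n with () ← trans (sym (ℤP.*-zeroʳ (↧ q))) ↧q*0≡1+n
    unscale g@(suc _) ↥q*g≡z ↧q*g≡1+n =
      (begin
        floor q * + suc n       ≡⟨ cong (floor q *_) ↧q*g≡1+n ⟨
        floor q * (↧ q * + g)   ≡⟨ ℤP.*-assoc (floor q) (↧ q) (+ g) ⟨
        floor q * ↧ q * + g     ≤⟨ ℤP.*-monoʳ-≤-nonNeg (+ g) (floor*↧≤↥ q) ⟩
        ↥ q * + g               ≡⟨ ↥q*g≡z ⟩
        z                       ∎)
      , (begin-strict
        z                              ≡⟨ ↥q*g≡z ⟨
        ↥ q * + g                      <⟨ ℤP.*-monoʳ-<-pos (+ g) (↥<suc[floor]*↧ q) ⟩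
        ℤ.suc (floor q) * ↧ q * + g    ≡⟨ ℤP.*-assoc (ℤ.suc (floor q)) (↧ q) (+ g) ⟩
        ℤ.suc (floor q) * (↧ q * + g)  ≡⟨ cong (ℤ.suc (floor q) *_) ↧q*g≡1+n ⟩
        ℤ.suc (floor q) * + suc n      ∎)
      where open ℤP.≤-Reasoning

  <suc⇒≤ : ∀ {i j} → i < ℤ.suc j → i ≤ j
  <suc⇒≤ {i} {j} i<suc[j] = subst (i ≤_) (ℤP.pred-suc j) (ℤP.i<j⇒i≤pred[j] i<suc[j])

  module _ (n : ℕ) where

    ⌊/suc⌋*≤ : ∀ z → ⌊ z /suc n ⌋ * + suc n ≤ z
    ⌊/suc⌋*≤ z = proj₁ (⌊/suc⌋-bounds z n)

    <suc⌊/suc⌋* : ∀ z → z < ℤ.suc ⌊ z /suc n ⌋ * + suc n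
    <suc⌊/suc⌋* z = proj₂ (⌊/suc⌋-bounds z n)

    ⌊/suc⌋-greatest : ∀ {m z} → m * + suc n ≤ z → m ≤ ⌊ z /suc n ⌋
    ⌊/suc⌋-greatest {m} {z} m*N≤z =
      <suc⇒≤ (ℤP.*-cancelʳ-<-nonNeg (+ suc n) (ℤP.≤-<-trans m*N≤z (<suc⌊/suc⌋* z)))

    ⌊/suc⌋-least : ∀ {m z} → z < ℤ.suc m * + suc n → ⌊ z /suc n ⌋ ≤ m
    ⌊/suc⌋-least {m} {z} z<suc[m]*N =
      <suc⇒≤ (ℤP.*-cancelʳ-<-nonNeg (+ suc n) (ℤP.≤-<-trans (⌊/suc⌋*≤ z) z<suc[m]*N))

    ⌊/suc⌋-mono-≤ : ∀ {z z′} → z ≤ z′ → ⌊ z /suc n ⌋ ≤ ⌊ z′ /suc n ⌋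
    ⌊/suc⌋-mono-≤ {z} z≤z′ = ⌊/suc⌋-greatest (ℤP.≤-trans (⌊/suc⌋*≤ z) z≤z′)

    ⌊+/suc⌋≤⌊/suc⌋+ : ∀ z {Δ k} → Δ ≤ k * + suc n → ⌊ z + Δ /suc n ⌋ ≤ ⌊ z /suc n ⌋ + k
    ⌊+/suc⌋≤⌊/suc⌋+ z {Δ} {k} Δ≤k*N = ⌊/suc⌋-least (begin-strict
      z + Δ                                      <⟨ ℤP.+-mono-<-≤ (<suc⌊/suc⌋* z) Δ≤k*N ⟩
      ℤ.suc ⌊ z /suc n ⌋ * + suc n + k * + suc n ≡⟨ ℤP.*-distribʳ-+ (+ suc n) (ℤ.suc ⌊ z /suc n ⌋) k ⟨
      (ℤ.suc ⌊ z /suc n ⌋ + k) * + suc n         ≡⟨ cong (_* + suc n) (ℤP.+-assoc (+ 1) ⌊ z /suc n ⌋ k) ⟩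
      ℤ.suc (⌊ z /suc n ⌋ + k) * + suc n         ∎)
      where open ℤP.≤-Reasoning

    suc⌊/suc⌋≤⌊+suc/suc⌋ : ∀ z → ℤ.suc ⌊ z /suc n ⌋ ≤ ⌊ z + + suc n /suc n ⌋
    suc⌊/suc⌋≤⌊+suc/suc⌋ z = ⌊/suc⌋-greatest (begin
      ℤ.suc ⌊ z /suc n ⌋ * + suc n     ≡⟨ ℤP.suc-* ⌊ z /suc n ⌋ (+ suc n) ⟩
      + suc n + ⌊ z /suc n ⌋ * + suc n ≤⟨ ℤP.+-monoʳ-≤ (+ suc n) (⌊/suc⌋*≤ z) ⟩
      + suc n + z                      ≡⟨ ℤP.+-comm (+ suc n) z ⟩
      z + + suc n                      ∎)
      where open ℤP.≤-Reasoning

    -- Of two points at distance c ∈ [1, n], shifting both by n moves at least one across a multiple of 1 + n.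
    ⌊/suc⌋-window : ∀ z {c} → 1 ℕ.≤ c → c ℕ.≤ n →
      ⌊ z + + c /suc n ⌋ + ⌊ z /suc n ⌋ < ⌊ z + + c + + n /suc n ⌋ + ⌊ z + + n /suc n ⌋
    ⌊/suc⌋-window z {c} 1≤c c≤n =
      subst (⌊ z + + c /suc n ⌋ + ⌊ z /suc n ⌋ <_) (ℤP.+-comm ⌊ z + + n /suc n ⌋ ⌊ z + + c + + n /suc n ⌋)
        (ℤP.+-mono-≤-< (⌊/suc⌋-mono-≤ {z + + c} (ℤP.+-monoʳ-≤ z (ℤ.+≤+ c≤n)))
                       (ℤP.suc[i]≤j⇒i<j (ℤP.≤-trans (suc⌊/suc⌋≤⌊+suc/suc⌋ z) (⌊/suc⌋-mono-≤ z+1+n≤z+c+n))))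
      where
      z+1+n≤z+c+n : z + + suc n ≤ z + + c + + n
      z+1+n≤z+c+n = begin
        z + + suc n     ≤⟨ ℤP.+-monoʳ-≤ z (ℤ.+≤+ (ℕP.+-monoˡ-≤ n 1≤c)) ⟩
        z + + (c ℕ.+ n) ≡⟨ cong (ℤ._+_ z) (ℤP.pos-+ c n) ⟩
        z + (+ c + + n) ≡⟨ ℤP.+-assoc z (+ c) (+ n) ⟨
        z + + c + + n   ∎
        where open ℤP.≤-Reasoning

open FloorDivision

module RationalBounds where
  open import Data.Integer using (_+_; _*_; _≤_)
  open import Data.Rational using (toℚᵘ)
  open import Data.Rational.Properties using (toℚᵘ-cancel-≤; toℚᵘ-homo-+; toℚᵘ-homo‿-; toℚᵘ-fromℚᵘ)
  open import Data.Rational.Unnormalised as ℚᵘ using (mkℚᵘ; *≤*)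
  import Data.Rational.Unnormalised.Properties as ℚᵘP

  toℚᵘ-toℚ : ∀ z → toℚᵘ (toℚ z) ℚᵘ.≃ mkℚᵘ z 0
  toℚᵘ-toℚ z = toℚᵘ-fromℚᵘ (mkℚᵘ z 0)

  ↧[mkℚᵘ+mkℚᵘ0] : ∀ u c n → ℚᵘ.↧ (mkℚᵘ u n ℚᵘ.+ mkℚᵘ c 0) ≡ + suc n
  ↧[mkℚᵘ+mkℚᵘ0] u c n = cong (λ m → + suc m) (ℕP.*-identityʳ n)

  /suc-toℚ≤toℚ : ∀ u c v n → u ≤ (v + c) * + suc n → u ℚ./ suc n ℚ.- toℚ c ℚ.≤ toℚ v
  /suc-toℚ≤toℚ u c v n u≤[v+c]*N = toℚᵘ-cancel-≤ (begin
    toℚᵘ (u ℚ./ suc n ℚ.- toℚ c)             ≃⟨ toℚᵘ-homo-+ (u ℚ./ suc n) (ℚ.- toℚ c) ⟩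
    toℚᵘ (u ℚ./ suc n) ℚᵘ.+ toℚᵘ (ℚ.- toℚ c) ≃⟨ ℚᵘP.+-cong (toℚᵘ-fromℚᵘ (mkℚᵘ u n))
                                                 (ℚᵘP.≃-trans (toℚᵘ-homo‿- (toℚ c)) (ℚᵘP.-‿cong (toℚᵘ-toℚ c))) ⟩
    mkℚᵘ u n ℚᵘ.- mkℚᵘ c 0                    ≤⟨ *≤* cross ⟩
    mkℚᵘ v 0                                  ≃⟨ toℚᵘ-toℚ v ⟨
    toℚᵘ (toℚ v)                              ∎)
    where
    open ℚᵘP.≤-Reasoning
    shape : ∀ u c N → u + ℤ.- c * N ≡ (u * + 1 + ℤ.- c * N) * + 1
    shape = solve-∀
    cancel : ∀ v c N → (v + c) * N + ℤ.- c * N ≡ v * N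
    cancel = solve-∀
    cross : (u * + 1 + ℤ.- c * + suc n) * + 1 ≤ v * ℚᵘ.↧ (mkℚᵘ u n ℚᵘ.- mkℚᵘ c 0)
    cross = subst₂ _≤_ (shape u c (+ suc n))
      (trans (cancel v c (+ suc n)) (cong (v *_) (sym (↧[mkℚᵘ+mkℚᵘ0] u (ℤ.- c) n))))
      (ℤP.+-monoˡ-≤ (ℤ.- c * + suc n) u≤[v+c]*N)

  toℚ≤/suc+toℚ : ∀ u c v n → v * + suc n ≤ u + c * + suc n → toℚ v ℚ.≤ u ℚ./ suc n ℚ.+ toℚ c
  toℚ≤/suc+toℚ u c v n v*N≤u+c*N = toℚᵘ-cancel-≤ (begin
    toℚᵘ (toℚ v)                         ≃⟨ toℚᵘ-toℚ v ⟩
    mkℚᵘ v 0                             ≤⟨ *≤* cross ⟩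
    mkℚᵘ u n ℚᵘ.+ mkℚᵘ c 0               ≃⟨ ℚᵘP.+-cong (toℚᵘ-fromℚᵘ (mkℚᵘ u n)) (toℚᵘ-toℚ c) ⟨
    toℚᵘ (u ℚ./ suc n) ℚᵘ.+ toℚᵘ (toℚ c) ≃⟨ toℚᵘ-homo-+ (u ℚ./ suc n) (toℚ c) ⟨
    toℚᵘ (u ℚ./ suc n ℚ.+ toℚ c)         ∎)
    where
    open ℚᵘP.≤-Reasoning
    shape : ∀ u c N → u + c * N ≡ (u * + 1 + c * N) * + 1
    shape = solve-∀
    cross : v * ℚᵘ.↧ (mkℚᵘ u n ℚᵘ.+ mkℚᵘ c 0) ≤ (u * + 1 + c * + suc n) * + 1
    cross = subst₂ _≤_ (cong (v *_) (sym (↧[mkℚᵘ+mkℚᵘ0] u c n))) (shape u c (+ suc n)) v*N≤u+c*N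

open RationalBounds

module Shifts where
  open import Data.Integer using (_+_; _-_; _≤_; _<_)

  +[m+n]-+o≡+m-+o++n : ∀ m n o → + (m ℕ.+ n) - + o ≡ + m - + o + + n
  +[m+n]-+o≡+m-+o++n m n o = trans (cong (_- + o) (ℤP.pos-+ m n)) (swap (+ m) (+ n) (+ o))
    where
    swap : ∀ a b c → a + b - c ≡ a - c + b
    swap = solve-∀

  private
    a-b≡[a+c]-[b+c] : ∀ a b c → a - b ≡ a + c - (b + c)
    a-b≡[a+c]-[b+c] = solve-∀

  -‿shift-≤ : ∀ a {b b′} c → b′ ≤ b + c → a - b ≤ a + c - b′
  -‿shift-≤ a {b} c b′≤b+c =
    subst (_≤ a + c - _) (sym (a-b≡[a+c]-[b+c] a b c)) (ℤP.+-monoʳ-≤ (a + c) (ℤP.neg-mono-≤ b′≤b+c))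

  -‿shift-< : ∀ a {b b′} c → b′ < b + c → a - b < a + c - b′
  -‿shift-< a {b} c b′<b+c =
    subst (_< a + c - _) (sym (a-b≡[a+c]-[b+c] a b c)) (ℤP.+-monoʳ-< (a + c) (ℤP.neg-mono-< b′<b+c))

open Shifts

-- d^ur and d^Iw as functions of k_•, for the divisor n + 1 (= p + 1), shifts τᵢ (= tᵢ) and d (= δ).
module Dimensions (n τ₁ τ₂ d : ℕ) where
  open import Data.Integer using (_+_; _-_; _*_; _≤_; _<_)

  z₁ z₂ : ℕ → ℤ
  z₁ kb = + kb - + τ₁
  z₂ kb = + kb - + τ₂

  ur : ℕ → ℤ
  ur kb = ⌊ z₁ kb /suc n ⌋ + ⌊ z₂ kb /suc n ⌋ + + 2

  iw : ℕ → ℤ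
  iw kb = + (2 ℕ.* kb ℕ.+ 2) - + (2 ℕ.* d)

  ur-+ : ∀ kb Δ → ur (kb ℕ.+ Δ) ≡ ⌊ z₁ kb + + Δ /suc n ⌋ + ⌊ z₂ kb + + Δ /suc n ⌋ + + 2
  ur-+ kb Δ = cong₂ (λ x y → ⌊ x /suc n ⌋ + ⌊ y /suc n ⌋ + + 2)
    (+[m+n]-+o≡+m-+o++n kb Δ τ₁) (+[m+n]-+o≡+m-+o++n kb Δ τ₂)

  iw-+ : ∀ kb Δ → iw (kb ℕ.+ Δ) ≡ iw kb + + (2 ℕ.* Δ)
  iw-+ kb Δ = begin
    + (2 ℕ.* (kb ℕ.+ Δ) ℕ.+ 2) - + (2 ℕ.* d)    ≡⟨ cong (λ m → + m - + (2 ℕ.* d)) (expand kb Δ) ⟩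
    + (2 ℕ.* kb ℕ.+ 2 ℕ.+ 2 ℕ.* Δ) - + (2 ℕ.* d) ≡⟨ +[m+n]-+o≡+m-+o++n (2 ℕ.* kb ℕ.+ 2) (2 ℕ.* Δ) (2 ℕ.* d) ⟩
    iw kb + + (2 ℕ.* Δ)                          ∎
    where
    open ≡-Reasoning
    expand : ∀ kb Δ → 2 ℕ.* (kb ℕ.+ Δ) ℕ.+ 2 ≡ 2 ℕ.* kb ℕ.+ 2 ℕ.+ 2 ℕ.* Δ
    expand = ℕ-Solver.solve-∀

  ur-mono-≤ : ∀ {kb kb′} → kb ℕ.≤ kb′ → ur kb ≤ ur kb′
  ur-mono-≤ {kb} kb≤kb′ with ℕP.m≤n⇒∃[o]m+o≡n kb≤kb′
  ... | Δ , refl = subst (ur kb ≤_) (sym (ur-+ kb Δ))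
    (ℤP.+-monoˡ-≤ (+ 2) (ℤP.+-mono-≤ (⌊/suc⌋-mono-≤ n (ℤP.i≤i+j (z₁ kb) (+ Δ)))
                                     (⌊/suc⌋-mono-≤ n (ℤP.i≤i+j (z₂ kb) (+ Δ)))))

  ur-+-≤ : ∀ kb {Δ k} → Δ ℕ.≤ k ℕ.* suc n → ur (kb ℕ.+ Δ) ≤ ur kb + + (2 ℕ.* k)
  ur-+-≤ kb {Δ} {k} Δ≤k*[1+n] = begin
    ur (kb ℕ.+ Δ)                                             ≡⟨ ur-+ kb Δ ⟩
    ⌊ z₁ kb + + Δ /suc n ⌋ + ⌊ z₂ kb + + Δ /suc n ⌋ + + 2         ≤⟨ ℤP.+-monoˡ-≤ (+ 2)
                                                                   (ℤP.+-mono-≤ (⌊+/suc⌋≤⌊/suc⌋+ n (z₁ kb) +Δ≤+k*+[1+n])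
                                                                                (⌊+/suc⌋≤⌊/suc⌋+ n (z₂ kb) +Δ≤+k*+[1+n])) ⟩
    (⌊ z₁ kb /suc n ⌋ + + k) + (⌊ z₂ kb /suc n ⌋ + + k) + + 2     ≡⟨ regroup ⌊ z₁ kb /suc n ⌋ ⌊ z₂ kb /suc n ⌋ (+ k) ⟩
    ur kb + + 2 * + k                                         ≡⟨ cong (_+_ (ur kb)) (ℤP.pos-* 2 k) ⟨
    ur kb + + (2 ℕ.* k)                                       ∎
    where
    open ℤP.≤-Reasoning
    +Δ≤+k*+[1+n] : + Δ ≤ + k * + suc n
    +Δ≤+k*+[1+n] = subst (+ Δ ≤_) (ℤP.pos-* k (suc n)) (ℤ.+≤+ Δ≤k*[1+n])
    regroup : ∀ a b k → a + k + (b + k) + + 2 ≡ a + b + + 2 + + 2 * k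
    regroup = solve-∀

  iw-ur-mono-≤ : ∀ {kb kb′} → kb ℕ.≤ kb′ → iw kb - ur kb ≤ iw kb′ - ur kb′
  iw-ur-mono-≤ {kb} kb≤kb′ with ℕP.m≤n⇒∃[o]m+o≡n kb≤kb′
  ... | Δ , refl = subst (λ x → iw kb - ur kb ≤ x - ur (kb ℕ.+ Δ)) (sym (iw-+ kb Δ))
    (-‿shift-≤ (iw kb) (+ (2 ℕ.* Δ)) (ur-+-≤ kb {k = Δ} (ℕP.m≤m*n Δ (suc n))))

  iw-ur-mono-< : 1 ℕ.≤ n → ∀ {kb kb′} → kb ℕ.+ 2 ℕ.≤ kb′ → iw kb - ur kb < iw kb′ - ur kb′
  iw-ur-mono-< 1≤n {kb} kb+2≤kb′ with ℕP.m≤n⇒∃[o]m+o≡n kb+2≤kb′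
  ... | Δ , refl rewrite ℕP.+-assoc kb 2 Δ =
    subst (λ x → iw kb - ur kb < x - ur (kb ℕ.+ (2 ℕ.+ Δ))) (sym (iw-+ kb (2 ℕ.+ Δ)))
      (-‿shift-< (iw kb) (+ (2 ℕ.* (2 ℕ.+ Δ)))
        (ℤP.≤-<-trans (ur-+-≤ kb {k = 1 ℕ.+ Δ} 2+Δ≤[1+Δ]*[1+n])
                      (ℤP.+-monoʳ-< (ur kb) (ℤ.+<+ (ℕP.*-monoʳ-< 2 (ℕP.n<1+n (1 ℕ.+ Δ)))))))
    where
    2+Δ≤[1+Δ]*[1+n] : 2 ℕ.+ Δ ℕ.≤ (1 ℕ.+ Δ) ℕ.* suc n
    2+Δ≤[1+Δ]*[1+n] = ℕP.≤-trans (ℕP.+-monoʳ-≤ 2 (ℕP.m≤m*n Δ 2)) (ℕP.*-monoʳ-≤ (1 ℕ.+ Δ) (s≤s 1≤n))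

  ur-<-+n : ∀ {c} → τ₂ ≡ τ₁ ℕ.+ c → 1 ℕ.≤ c → c ℕ.≤ n → ∀ kb → ur kb < ur (kb ℕ.+ n)
  ur-<-+n {c} τ₂≡τ₁+c 1≤c c≤n kb = begin-strict
    ur kb                                                           ≡⟨ cong (λ x → ⌊ x /suc n ⌋ + ⌊ z /suc n ⌋ + + 2) z₁≡z+c ⟩
    ⌊ z + + c /suc n ⌋ + ⌊ z /suc n ⌋ + + 2                           <⟨ ℤP.+-monoˡ-< (+ 2) (⌊/suc⌋-window n z 1≤c c≤n) ⟩
    ⌊ z + + c + + n /suc n ⌋ + ⌊ z + + n /suc n ⌋ + + 2               ≡⟨ cong (λ x → ⌊ x + + n /suc n ⌋ + ⌊ z + + n /suc n ⌋ + + 2) z₁≡z+c ⟨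
    ⌊ z₁ kb + + n /suc n ⌋ + ⌊ z + + n /suc n ⌋ + + 2                 ≡⟨ ur-+ kb n ⟨
    ur (kb ℕ.+ n)                                                   ∎
    where
    open ℤP.≤-Reasoning
    z : ℤ
    z = z₂ kb
    k-t≡k-[t+c]+c : ∀ k t c → k - t ≡ k - (t + c) + c
    k-t≡k-[t+c]+c = solve-∀
    z₁≡z+c : z₁ kb ≡ z + + c
    z₁≡z+c = trans (k-t≡k-[t+c]+c (+ kb) (+ τ₁) (+ c))
                   (cong (λ t → + kb - t + + c) (trans (sym (ℤP.pos-+ τ₁ c)) (cong +_ (sym τ₂≡τ₁+c))))

  ur-≡⇒<+n : ∀ {c} → τ₂ ≡ τ₁ ℕ.+ c → 1 ℕ.≤ c → c ℕ.≤ n → ∀ {kb kb′} → ur kb ≡ ur kb′ → kb′ ℕ.< kb ℕ.+ n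
  ur-≡⇒<+n τ₂≡τ₁+c 1≤c c≤n {kb} {kb′} ur≡ with kb′ ℕ.<? kb ℕ.+ n
  ... | yes kb′<kb+n = kb′<kb+n
  ... | no kb′≮kb+n = contradiction ur≡
    (ℤP.<⇒≢ (ℤP.<-≤-trans (ur-<-+n τ₂≡τ₁+c 1≤c c≤n kb) (ur-mono-≤ (ℕP.≮⇒≥ kb′≮kb+n))))

  iw-ur-≡⇒<+2 : 1 ℕ.≤ n → ∀ {kb kb′} → iw kb - ur kb ≡ iw kb′ - ur kb′ → kb′ ℕ.< kb ℕ.+ 2
  iw-ur-≡⇒<+2 1≤n {kb} {kb′} iw-ur≡ with kb′ ℕ.<? kb ℕ.+ 2
  ... | yes kb′<kb+2 = kb′<kb+2
  ... | no kb′≮kb+2 = contradiction iw-ur≡ (ℤP.<⇒≢ (iw-ur-mono-< 1≤n (ℕP.≮⇒≥ kb′≮kb+2)))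

  2kb≡z₁+z₂+[τ₁+τ₂] : ∀ kb → + (2 ℕ.* kb) ≡ z₁ kb + z₂ kb + + (τ₁ ℕ.+ τ₂)
  2kb≡z₁+z₂+[τ₁+τ₂] kb = trans (ℤP.pos-* 2 kb)
    (trans (split (+ kb) (+ τ₁) (+ τ₂)) (cong (_+_ (z₁ kb + z₂ kb)) (sym (ℤP.pos-+ τ₁ τ₂))))
    where
    split : ∀ k a b → + 2 * k ≡ (k - a) + (k - b) + (a + b)
    split = solve-∀

  2kb≤[ur+2]*[1+n] : τ₁ ℕ.+ τ₂ ℕ.≤ 2 ℕ.* suc n → ∀ kb → + (2 ℕ.* kb) ≤ (ur kb + + 2) * + suc n
  2kb≤[ur+2]*[1+n] τ₁+τ₂≤2[1+n] kb = begin
    + (2 ℕ.* kb)                                           ≡⟨ 2kb≡z₁+z₂+[τ₁+τ₂] kb ⟩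
    z₁ kb + z₂ kb + + (τ₁ ℕ.+ τ₂)                          ≤⟨ ℤP.+-mono-≤
                                                               (ℤP.+-mono-≤ (ℤP.<⇒≤ (<suc⌊/suc⌋* n (z₁ kb))) (ℤP.<⇒≤ (<suc⌊/suc⌋* n (z₂ kb))))
                                                               (subst (+ (τ₁ ℕ.+ τ₂) ≤_) (ℤP.pos-* 2 (suc n)) (ℤ.+≤+ τ₁+τ₂≤2[1+n])) ⟩
    ℤ.suc ⌊ z₁ kb /suc n ⌋ * + suc n + ℤ.suc ⌊ z₂ kb /suc n ⌋ * + suc n + + 2 * + suc n
                                                           ≡⟨ collect ⌊ z₁ kb /suc n ⌋ ⌊ z₂ kb /suc n ⌋ (+ suc n) ⟩
    (ur kb + + 2) * + suc n                                ∎
    where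
    open ℤP.≤-Reasoning
    collect : ∀ a b N → (+ 1 + a) * N + (+ 1 + b) * N + + 2 * N ≡ (a + b + + 2 + + 2) * N
    collect = solve-∀

  ur*[1+n]≤2kb+2[1+n] : ∀ kb → ur kb * + suc n ≤ + (2 ℕ.* kb) + + 2 * + suc n
  ur*[1+n]≤2kb+2[1+n] kb = begin
    ur kb * + suc n                                                        ≡⟨ expand ⌊ z₁ kb /suc n ⌋ ⌊ z₂ kb /suc n ⌋ (+ suc n) ⟩
    ⌊ z₁ kb /suc n ⌋ * + suc n + ⌊ z₂ kb /suc n ⌋ * + suc n + + 2 * + suc n ≤⟨ ℤP.+-monoˡ-≤ (+ 2 * + suc n)
                                                                              (ℤP.+-mono-≤ (⌊/suc⌋*≤ n (z₁ kb)) (⌊/suc⌋*≤ n (z₂ kb))) ⟩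
    z₁ kb + z₂ kb + + 2 * + suc n                                          ≤⟨ ℤP.+-monoˡ-≤ (+ 2 * + suc n) z₁+z₂≤2kb ⟩
    + (2 ℕ.* kb) + + 2 * + suc n                                           ∎
    where
    open ℤP.≤-Reasoning
    expand : ∀ a b N → (a + b + + 2) * N ≡ a * N + b * N + + 2 * N
    expand = solve-∀
    z₁+z₂≤2kb : z₁ kb + z₂ kb ≤ + (2 ℕ.* kb)
    z₁+z₂≤2kb = subst (z₁ kb + z₂ kb ≤_) (sym (2kb≡z₁+z₂+[τ₁+τ₂] kb)) (ℤP.i≤i+j (z₁ kb + z₂ kb) (+ (τ₁ ℕ.+ τ₂)))

-- ℕ's arithmetic operators are opened only from here on; the modules above use those of ℤ unqualified.
open import Data.Nat using (_+_; _*_; _≤_; _<_; _∸_; _%_; _/_; _<?_)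
open import Data.Nat.DivMod using (m≡m%n+[m/n]*n; m%n<n; m%n%n≡m%n; [m+kn]%n≡m%n; %-distribˡ-+; m*n/n≡m; m<n*o⇒m/o<n; m<n⇒m%n≡m; [m+n]%n≡m%n)
open import Data.Nat.Divisibility using (∣m+n∣m⇒∣n; ∣⇒≤; n∣m*n) renaming (_∣_ to _∣ℕ_)
open import Data.Nat.Primality using (Prime)
open import Data.Integer.Divisibility using () renaming (_∣_ to _∣ℤ_)

-- Adding c * d ∸ c, which is −c modulo d, undoes the shift by c.
+-cancelˡ-% : ∀ c {x y d} .{{_ : NonZero d}} → (c + x) % d ≡ (c + y) % d → x % d ≡ y % d
+-cancelˡ-% c {x} {y} {d} [c+x]%d≡[c+y]%d = begin
  x % d                               ≡⟨ via x ⟩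
  ((c + x) % d + (c * d ∸ c) % d) % d ≡⟨ cong (λ r → (r + (c * d ∸ c) % d) % d) [c+x]%d≡[c+y]%d ⟩
  ((c + y) % d + (c * d ∸ c) % d) % d ≡⟨ via y ⟨
  y % d                               ∎
  where
  open ≡-Reasoning
  regroup : ∀ z → z + c * d ≡ c + z + (c * d ∸ c)
  regroup z = trans (cong (_+_ z) (sym (ℕP.m+[n∸m]≡n (ℕP.m≤m*n c d))))
                    (trans (sym (ℕP.+-assoc z c (c * d ∸ c))) (cong (_+ (c * d ∸ c)) (ℕP.+-comm z c)))
  via : ∀ z → z % d ≡ ((c + z) % d + (c * d ∸ c) % d) % d
  via z = trans (sym ([m+kn]%n≡m%n z c d)) (trans (cong (_% d) (regroup z)) (%-distribˡ-+ (c + z) (c * d ∸ c) d))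

m%n≡r⇒m≡r+[m∸r]/n*n : ∀ {m r n} .{{_ : NonZero n}} → m % n ≡ r → m ≡ r + (m ∸ r) / n * n
m%n≡r⇒m≡r+[m∸r]/n*n {m} {r} {n} m%n≡r = trans m≡r+[m/n]*n (cong (λ q → r + q * n) (sym [m∸r]/n≡m/n))
  where
  m≡r+[m/n]*n : m ≡ r + m / n * n
  m≡r+[m/n]*n = trans (m≡m%n+[m/n]*n m n) (cong (_+ m / n * n) m%n≡r)
  [m∸r]/n≡m/n : (m ∸ r) / n ≡ m / n
  [m∸r]/n≡m/n = trans (cong (λ x → (x ∸ r) / n) m≡r+[m/n]*n)
                      (trans (cong (_/ n) (ℕP.m+n∸m≡n r (m / n * n))) (m*n/n≡m (m / n) n))

1+n∤m*n : ∀ {m n} → 0 < m → m ≤ n → ¬ (suc n ∣ℕ m * n)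
1+n∤m*n {m@(suc _)} {n} _ m≤n 1+n∣m*n = ℕP.<⇒≱ (s≤s m≤n) (∣⇒≤ 1+n∣m)
  where
  1+n∣m : suc n ∣ℕ m
  1+n∣m = ∣m+n∣m⇒∣n (subst (suc n ∣ℕ_) (trans (ℕP.*-suc m n) (ℕP.+-comm m (m * n))) (n∣m*n m)) 1+n∣m*n

∣+m-+n∣≡n∸m : ∀ {m n} → m < n → ℤ.∣ + m ℤ.- + n ∣ ≡ n ∸ m
∣+m-+n∣≡n∸m {m} {n} m<n = trans (cong ℤ.∣_∣ (ℤP.m-n≡m⊖n m n)) (ℤP.∣⊖∣-< m<n)

-- With p = m + 2 the divisor p ∸ 1 of res, δ and kbul reduces to suc m.
module Setting (m a s : ℕ) (a+5≤p : a + 5 ≤ suc (suc m)) (s+2≤p : s + 2 ≤ suc (suc m)) where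

  p : ℕ
  p = suc (suc m)

  open Dimensions p (t₁ p a s) (t₂ p a s) (δ p a s)

  s≤m : s ≤ m
  s≤m = ℕP.+-cancelʳ-≤ 2 s m (subst (s + 2 ≤_) (ℕP.+-comm 2 m) s+2≤p)

  a+3≤m : a + 3 ≤ m
  a+3≤m = ℕP.+-cancelʳ-≤ 2 (a + 3) m (subst₂ _≤_ (sym (ℕP.+-assoc a 3 2)) (ℕP.+-comm 2 m) a+5≤p)

  δ≤1 : δ p a s ≤ 1
  δ≤1 = s≤s⁻¹ (m<n*o⇒m/o<n {o = suc m} (ℕP.≤-<-trans
    (ℕP.m∸n≤m ((a + s) % suc m + s) ((a + 2 * s) % suc m))
    (ℕP.≤-trans (s≤s (ℕP.+-mono-≤ (s≤s⁻¹ (m%n<n (a + s) (suc m))) s≤m))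
                (ℕP.≤-trans (ℕP.n≤1+n _) (ℕP.≤-reflexive (2+m+m≡2*[1+m] m))))))
    where
    2+m+m≡2*[1+m] : ∀ m → suc (suc (m + m)) ≡ 2 * suc m
    2+m+m≡2*[1+m] = ℕ-Solver.solve-∀

  t₁+t₂≤2[1+p] : t₁ p a s + t₂ p a s ≤ 2 * suc p
  t₁+t₂≤2[1+p] with a + s <? suc m
  ... | yes a+s<1+m = ℕP.≤-trans
    (ℕP.+-mono-≤ (ℕP.+-mono-≤ s≤m δ≤1) (ℕP.+-monoˡ-≤ 2 (ℕP.+-mono-≤ (s≤s⁻¹ a+s<1+m) δ≤1)))
    (ℕP.≤-trans (ℕP.m≤m+n _ 2) (ℕP.≤-reflexive (total m)))
    where
    total : ∀ m → m + 1 + (m + 1 + 2) + 2 ≡ 2 * suc (suc (suc m))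
    total = ℕ-Solver.solve-∀
  ... | no _ = ℕP.≤-trans
    (ℕP.+-mono-≤ (ℕP.+-monoˡ-≤ 1 (ℕP.+-mono-≤ (s≤s⁻¹ (m%n<n (a + s) (suc m))) δ≤1))
                 (ℕP.+-monoˡ-≤ 1 (ℕP.+-mono-≤ s≤m δ≤1)))
    (ℕP.≤-trans (ℕP.m≤m+n _ 2) (ℕP.≤-reflexive (total m)))
    where
    total : ∀ m → m + 1 + 1 + (m + 1 + 1) + 2 ≡ 2 * suc (suc (suc m))
    total = ℕ-Solver.solve-∀

  t₂≡t₁+c : Σ[ c ∈ ℕ ] 1 ≤ c × c ≤ p × t₂ p a s ≡ t₁ p a s + c
  t₂≡t₁+c with a + s <? suc m
  ... | yes _ = a + 2 , ℕP.≤-trans (s≤s z≤n) (ℕP.m≤n+m 2 a) , ℕP.≤-trans (ℕP.+-monoʳ-≤ a (ℕP.m≤m+n 2 3)) a+5≤p , regroup a s (δ p a s)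
    where
    regroup : ∀ a s d → a + s + d + 2 ≡ s + d + (a + 2)
    regroup = ℕ-Solver.solve-∀
  ... | no a+s≮1+m = suc m ∸ a , ℕP.m<n⇒0<n∸m a<1+m , ℕP.≤-trans (ℕP.m∸n≤m (suc m) a) (ℕP.n≤1+n (suc m)) , t₂≡
    where
    a<1+m : a < suc m
    a<1+m = s≤s (ℕP.≤-trans (ℕP.m≤m+n a 3) a+3≤m)
    x : ℕ
    x = a + s ∸ suc m
    x+[1+m]≡a+s : x + suc m ≡ a + s
    x+[1+m]≡a+s = ℕP.m∸n+n≡m (ℕP.≮⇒≥ a+s≮1+m)
    x<1+m : x < suc m
    x<1+m = ℕP.+-cancelʳ-< (suc m) x (suc m) (subst (_< suc m + suc m) (sym x+[1+m]≡a+s)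
      (ℕP.≤-trans (s≤s (ℕP.+-mono-≤ (ℕP.≤-trans (ℕP.m≤m+n a 3) a+3≤m) s≤m)) (ℕP.+-monoʳ-≤ (suc m) (ℕP.n≤1+n m))))
    [a+s]%[1+m]≡x : (a + s) % suc m ≡ x
    [a+s]%[1+m]≡x = trans (cong (_% suc m) (sym x+[1+m]≡a+s)) (trans ([m+n]%n≡m%n x (suc m)) (m<n⇒m%n≡m x<1+m))
    x+[1+m∸a]≡s : x + (suc m ∸ a) ≡ s
    x+[1+m∸a]≡s = ℕP.+-cancelʳ-≡ a (x + (suc m ∸ a)) s (trans (ℕP.+-assoc x (suc m ∸ a) a)
      (trans (cong (_+_ x) (ℕP.m∸n+n≡m (ℕP.<⇒≤ a<1+m))) (trans x+[1+m]≡a+s (ℕP.+-comm a s))))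
    regroup : ∀ x c d → x + c + d + 1 ≡ x + d + 1 + c
    regroup = ℕ-Solver.solve-∀
    t₂≡ : s + δ p a s + 1 ≡ (a + s) % suc m + δ p a s + 1 + (suc m ∸ a)
    t₂≡ = trans (cong (λ y → y + δ p a s + 1) (sym x+[1+m∸a]≡s))
            (trans (regroup x (suc m ∸ a) (δ p a s)) (cong (λ y → y + δ p a s + 1 + (suc m ∸ a)) (sym [a+s]%[1+m]≡x)))

  k≡kε+kbul*[p∸1] : ∀ {k} → inK p a s k → k ≡ kε p a s + kbul p a s k * suc m
  k≡kε+kbul*[p∸1] {suc (suc k₀)} (s≤s (s≤s _) , k%≡kε%) = cong (_+_ 2) (m%n≡r⇒m≡r+[m∸r]/n*n k₀%≡r)
    where
    k₀%≡r : k₀ % suc m ≡ (a + 2 * s) % suc m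
    k₀%≡r = trans (+-cancelˡ-% 2 {k₀} {(a + 2 * s) % suc m} k%≡kε%) (m%n%n≡m%n (a + 2 * s) (suc m))

  kbul-< : ∀ {k k′} → inK p a s k → inK p a s k′ → k < k′ → kbul p a s k < kbul p a s k′
  kbul-< {k} {k′} hk hk′ k<k′ = ℕP.*-cancelʳ-< (suc m) (kbul p a s k) (kbul p a s k′)
    (ℕP.+-cancelˡ-< (kε p a s) _ _ (subst₂ _<_ (k≡kε+kbul*[p∸1] hk) (k≡kε+kbul*[p∸1] hk′) k<k′))

  k′∸k≡[kb′∸kb]*[p∸1] : ∀ {k k′} → inK p a s k → inK p a s k′ → k′ ∸ k ≡ (kbul p a s k′ ∸ kbul p a s k) * suc m
  k′∸k≡[kb′∸kb]*[p∸1] {k} {k′} hk hk′ = trans (cong₂ _∸_ (k≡kε+kbul*[p∸1] hk′) (k≡kε+kbul*[p∸1] hk))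
    (trans (ℕP.[m+n]∸[m+o]≡n∸o (kε p a s) _ _) (sym (ℕP.*-distribʳ-∸ (suc m) (kbul p a s k′) (kbul p a s k))))

  DimensionsCoincide : ℕ → ℕ → Set
  DimensionsCoincide k k′ =
    dUr p a s k ≡ dUr p a s k′ ⊎ dIw p a s k ℤ.- dUr p a s k ≡ dIw p a s k′ ℤ.- dUr p a s k′

  dUr-bounds : (k : ℕ) →
    (((+ (2 * kbul p a s k)) ℚ./ suc p) ℚ.- toℚ (+ 2) ℚ.≤ toℚ (dUr p a s k))
    × (toℚ (dUr p a s k) ℚ.≤ ((+ (2 * kbul p a s k)) ℚ./ suc p) ℚ.+ toℚ (+ 2))
  dUr-bounds k =
    /suc-toℚ≤toℚ (+ (2 * kb)) (+ 2) (ur kb) p (2kb≤[ur+2]*[1+n] t₁+t₂≤2[1+p] kb) ,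
    toℚ≤/suc+toℚ (+ (2 * kb)) (+ 2) (ur kb) p (ur*[1+n]≤2kb+2[1+n] kb)
    where
    kb : ℕ
    kb = kbul p a s k

  dims-monotone : ∀ {k k′} → inK p a s k → inK p a s k′ → k < k′ →
    (dUr p a s k ℤ.≤ dUr p a s k′)
    × (dIw p a s k ℤ.- dUr p a s k ℤ.≤ dIw p a s k′ ℤ.- dUr p a s k′)
    × (kbul p a s k + 2 ≤ kbul p a s k′ →
         dIw p a s k ℤ.- dUr p a s k ℤ.< dIw p a s k′ ℤ.- dUr p a s k′)
  dims-monotone {k} {k′} hk hk′ k<k′ = ur-mono-≤ kb≤kb′ , iw-ur-mono-≤ kb≤kb′ , iw-ur-mono-< (s≤s z≤n)
    where
    kb≤kb′ : kbul p a s k ≤ kbul p a s k′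
    kb≤kb′ = ℕP.<⇒≤ (kbul-< hk hk′ k<k′)

  dims-coincide⇒kb′<kb+p : ∀ {k k′} → DimensionsCoincide k k′ →
    kbul p a s k′ < kbul p a s k + p
  dims-coincide⇒kb′<kb+p {k} {k′} (inj₁ ur≡) with t₂≡t₁+c
  ... | c , 1≤c , c≤p , t₂≡t₁+c′ = ur-≡⇒<+n t₂≡t₁+c′ 1≤c c≤p {kbul p a s k} {kbul p a s k′} ur≡
  dims-coincide⇒kb′<kb+p {k} {k′} (inj₂ iw-ur≡) = ℕP.<-≤-trans
    (iw-ur-≡⇒<+2 (s≤s z≤n) {kbul p a s k} {kbul p a s k′} iw-ur≡) (ℕP.+-monoʳ-≤ (kbul p a s k) (s≤s (s≤s z≤n)))

  dims-coincide⇒p∤k′∸k : ∀ {k k′} → inK p a s k → inK p a s k′ → k < k′ →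
    DimensionsCoincide k k′ →
    ¬ (p ∣ℕ k′ ∸ k)
  dims-coincide⇒p∤k′∸k {k} {k′} hk hk′ k<k′ coincidence p∣k′∸k =
    1+n∤m*n (ℕP.m<n⇒0<n∸m kb<kb′) kb′∸kb≤1+m (subst (p ∣ℕ_) (k′∸k≡[kb′∸kb]*[p∸1] hk hk′) p∣k′∸k)
    where
    kb kb′ : ℕ
    kb = kbul p a s k
    kb′ = kbul p a s k′
    kb<kb′ : kb < kb′
    kb<kb′ = kbul-< hk hk′ k<k′
    kb′∸kb≤1+m : kb′ ∸ kb ≤ suc m
    kb′∸kb≤1+m = s≤s⁻¹ (subst (kb′ ∸ kb <_) (ℕP.m+n∸m≡n kb p)
      (ℕP.∸-monoˡ-< (dims-coincide⇒kb′<kb+p {k} {k′} coincidence) (ℕP.<⇒≤ kb<kb′)))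

  dims-separate : ∀ {k k′} → inK p a s k → inK p a s k′ → k ≢ k′ →
    DimensionsCoincide k k′ →
    ¬ ((+ p) ∣ℤ ((+ k) ℤ.- (+ k′)))
  dims-separate {k} {k′} hk hk′ k≢k′ coincidence p∣k-k′ with ℕP.<-cmp k k′
  ... | tri< k<k′ _ _ = dims-coincide⇒p∤k′∸k hk hk′ k<k′ coincidence
    (subst (p ∣ℕ_) (∣+m-+n∣≡n∸m k<k′) p∣k-k′)
  ... | tri≈ _ k≡k′ _ = k≢k′ k≡k′
  ... | tri> _ _ k′<k = dims-coincide⇒p∤k′∸k hk′ hk k′<k (Sum.map sym sym coincidence)
    (subst (p ∣ℕ_) (trans (ℤP.∣i-j∣≡∣j-i∣ (+ k) (+ k′)) (∣+m-+n∣≡n∸m k′<k)) p∣k-k′)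

lemma3p3 : (p a s : ℕ) → Prime p → 11 ≤ p → 2 ≤ a → a + 5 ≤ p → s + 2 ≤ p →
    ((k : ℕ) → inK p a s k →
       (((+ (2 * kbul p a s k)) ℚ./ suc p) ℚ.- toℚ (+ 2) ℚ.≤ toℚ (dUr p a s k))
       × (toℚ (dUr p a s k) ℚ.≤ ((+ (2 * kbul p a s k)) ℚ./ suc p) ℚ.+ toℚ (+ 2)))
    × ((k k′ : ℕ) → inK p a s k → inK p a s k′ → k < k′ →
       (dUr p a s k ℤ.≤ dUr p a s k′)
       × (dIw p a s k ℤ.- dUr p a s k ℤ.≤ dIw p a s k′ ℤ.- dUr p a s k′)
       × (kbul p a s k + 2 ≤ kbul p a s k′ →
            dIw p a s k ℤ.- dUr p a s k ℤ.< dIw p a s k′ ℤ.- dUr p a s k′))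
    × ((k k′ : ℕ) → inK p a s k → inK p a s k′ → k ≢ k′ →
       (dUr p a s k ≡ dUr p a s k′
         ⊎ dIw p a s k ℤ.- dUr p a s k ≡ dIw p a s k′ ℤ.- dUr p a s k′) →
       ¬ ((+ p) ∣ℤ ((+ k) ℤ.- (+ k′))))
lemma3p3 (suc (suc m)) a s _ _ _ a+5≤p s+2≤p =
  (λ k _ → dUr-bounds k) , (λ _ _ → dims-monotone) , (λ _ _ → dims-separate)
  where open Setting m a s a+5≤p s+2≤p
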